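{- Let $G$ be a graph with maximum degree at most $3$ and minimum degree at least $2$, let $\mathcal{S}$ be the set of vertices of degree $2$ in $G$ and $\mathcal{L}$ the set of vertices of degree $3$ in $G$, and suppose $G$ is bipartite with partite sets $\mathcal{S}$ and $\mathcal{L}$ (so both are independent sets). Then $\gamma_r(G) \le |\mathcal{L}|$.
   Context: All graphs are finite and simple. A restrained dominating set of a graph $G$ is a set $S\subseteq V(G)$ such that every vertex not in $S$ has a neighbor in $S$ and also has a neighbor not in $S$. The restrained domination number $\gamma_r(G)$ is the minimum cardinality of a restrained dominating set of $G$. -}

module Defs where

open import Data.Nat using (ℕ; _≤_; _≡ᵇ_)
open import Data.Bool using (Bool; true; false)
open import Data.Fin using (Fin)
open import Data.Fin.Subset using (Subset; _∈_; _∉_; ∣_∣)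
open import Data.Vec using (tabulate)
open import Data.List using (filter; length)
open import Data.Product using (Σ; _×_; ∃-syntax)
open import Relation.Binary.PropositionalEquality using (_≡_)
open import Relation.Nullary using (¬_)
open import Data.Bool.Properties using (T?)
open import Data.List using (allFin)

record Graph (n : ℕ) : Set where
  field
    adj     : Fin n → Fin n → Bool
    sym     : ∀ u v → adj u v ≡ adj v u
    irrefl  : ∀ v → adj v v ≡ false

open Graph public

_~[_]_ : ∀ {n} → Fin n → Graph n → Fin n → Set
u ~[ G ] v = adj G u v ≡ true

deg : ∀ {n} → Graph n → Fin n → ℕ
deg {n} G v = length (filter (λ u → T? (adj G v u)) (allFin n))

degSet : ∀ {n} → Graph n → ℕ → Subset n
degSet G d = tabulate (λ v → deg G v ≡ᵇ d)

Independent : ∀ {n} → Graph n → Subset n → Set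
Independent G A = ∀ u v → u ∈ A → v ∈ A → ¬ (u ~[ G ] v)

IsRestrainedDominating : ∀ {n} → Graph n → Subset n → Set
IsRestrainedDominating G S =
  ∀ v → v ∉ S →
    (∃[ u ] (v ~[ G ] u × u ∈ S)) × (∃[ u ] (v ~[ G ] u × u ∉ S))

-- γ_r(G) ≤ k  iff  some restrained dominating set has size ≤ k
-- (γ_r is the minimum size of such a set; V(G) itself is always one).
γr≤ : ∀ {n} → Graph n → ℕ → Set
γr≤ G k = ∃[ S ] (IsRestrainedDominating G S × ∣ S ∣ ≤ k)

-- Read each vertex of 𝒮 as an edge joining its two neighbours, which lie in ℒ; this makes G a
-- cubic multigraph on ℒ. Colour ℒ with two colours so that no single recolouring reduces the number
-- of monochromatic edges: a vertex on two monochromatic edges could be recoloured with gain, so the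
-- monochromatic edges form a matching. Let X be a colour class spanning at least as many edges as
-- the other class B, and let every x ∈ X choose an incident edge π x, its monochromatic one if it
-- has one. Then D = B ∪ π(X) ∪ {edges inside B} is restrained dominating: a vertex of ℒ outside D
-- lies in X, sees π x ∈ D, and sees only vertices outside D otherwise; an edge outside D has ends of
-- different colours, one in B ⊆ D and one outside D. An edge inside X is chosen by both its ends, so
-- |π(X)| + #(edges inside B) ≤ |π(X)| + #(edges inside X) ≤ |X|, whence |D| ≤ |B| + |X| = |ℒ|.

{-# OPTIONS --safe #-}
module Submission where

open import Defs hiding (sym)
open import Data.Bool using (Bool; true; false; not; _∧_; _∨_; _xor_; if_then_else_)
open import Data.Bool.Properties
  using (∧-conicalˡ; ∧-conicalʳ; ∨-conicalˡ; ∨-conicalʳ; ∧-identityʳ; ∨-identityʳ; ∨-zeroʳ;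
         ¬-not; not-¬; not-injective; not-involutive; not-distribˡ-xor; not-distribʳ-xor;
         xor-annihilates-not; T-≡)
import Data.Bool.Properties as Bool
open import Data.Empty using (⊥-elim)
open import Data.Fin using (Fin; zero; suc)
open import Data.Fin.Properties using (_≟_; any?)
open import Data.Fin.Subset using (_∈_; ∣_∣)
open import Data.List using (filter; length)
import Data.List as List
import Data.Nat as ℕ
open import Data.Nat using (ℕ; zero; suc; _+_; _≤_; _<_; z≤n; s≤s; s≤s⁻¹; _<?_; _≡ᵇ_)
open import Data.Nat.Induction using (<-wellFounded)
open import Data.Nat.Properties
  using (≤-refl; ≤-trans; <-irrefl; +-mono-≤; +-monoʳ-≤; +-monoˡ-≤; +-cancelˡ-≤; +-suc; +-comm;
         n≤1+n; suc-injective; ≮⇒≥; ≤-total; ≡⇒≡ᵇ; ≡ᵇ⇒≡; +-0-commutativeMonoid;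
         module ≤-Reasoning)
open import Algebra.Properties.CommutativeMonoid.Sum +-0-commutativeMonoid
  using (sum; sum-syntax; ∑-comm; ∑-distrib-+; sum-cong-≗; sum-replicate-zero)
open import Data.Product using (∃-syntax; _×_; _,_; proj₁; proj₂)
import Data.Product as Product
open import Data.Sum using (_⊎_; inj₁; inj₂; [_,_]′)
open import Data.Vec using (tabulate)
open import Data.Vec.Functional using (updateAt)
open import Data.Vec.Functional.Properties using (updateAt-updates; updateAt-minimal)
open import Data.Vec.Properties using (lookup⇒[]=; []=⇒lookup; lookup∘tabulate)
open import Function using (_∘_; id; Equivalence)
open import Induction.WellFounded using (Acc; acc)
open import Relation.Binary.PropositionalEquality
open import Relation.Nullary using (yes; no; does)
open import Relation.Nullary.Decidable using (dec-true; dec-false)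

𝟙 : Bool → ℕ
𝟙 b = if b then 1 else 0

size : ∀ {n} → (Fin n → Bool) → ℕ
size {n} p = ∑[ i < n ] 𝟙 (p i)

∑-mono-≤ : ∀ {n} {f g : Fin n → ℕ} → (∀ i → f i ≤ g i) → sum f ≤ sum g
∑-mono-≤ {zero}  f≤g = z≤n
∑-mono-≤ {suc n} f≤g = +-mono-≤ (f≤g zero) (∑-mono-≤ (f≤g ∘ suc))

size-∨ : ∀ {n} (p q : Fin n → Bool) → size (λ i → p i ∨ q i) ≤ size p + size q
size-∨ p q = begin
  size (λ i → p i ∨ q i)          ≤⟨ ∑-mono-≤ (λ i → 𝟙-∨ (p i) (q i)) ⟩
  ∑[ i < _ ] (𝟙 (p i) + 𝟙 (q i))  ≡⟨ ∑-distrib-+ (𝟙 ∘ p) (𝟙 ∘ q) ⟩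
  size p + size q                 ∎
  where
  open ≤-Reasoning
  𝟙-∨ : ∀ a b → 𝟙 (a ∨ b) ≤ 𝟙 a + 𝟙 b
  𝟙-∨ true  b = s≤s z≤n
  𝟙-∨ false b = ≤-refl

size-split : ∀ {n} (p q : Fin n → Bool) →
             size p ≡ size (λ i → p i ∧ q i) + size (λ i → p i ∧ not (q i))
size-split p q = trans (sum-cong-≗ λ i → 𝟙-split (p i) (q i))
                       (∑-distrib-+ (λ i → 𝟙 (p i ∧ q i)) (λ i → 𝟙 (p i ∧ not (q i))))
  where
  𝟙-split : ∀ a b → 𝟙 a ≡ 𝟙 (a ∧ b) + 𝟙 (a ∧ not b)
  𝟙-split true  true  = refl
  𝟙-split true  false = refl
  𝟙-split false b     = refl

size-≟ : ∀ {n} (i : Fin n) → size (λ j → does (i ≟ j)) ≡ 1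
size-≟ {suc n} zero    = cong suc (sum-replicate-zero n)
size-≟ {suc n} (suc i) = size-≟ i

size>0⇒∃ : ∀ {n} (p : Fin n → Bool) → 0 < size p → ∃[ i ] p i ≡ true
size>0⇒∃ {suc n} p pos with p zero in p0
... | true  = zero , p0
... | false = Product.map suc id (size>0⇒∃ (p ∘ suc) pos)

_-_ : ∀ {n} → (Fin n → Bool) → Fin n → Fin n → Bool
(p - i) j = p j ∧ not (does (j ≟ i))

-⁺ : ∀ {n} {p : Fin n → Bool} {i j} → p j ≡ true → j ≢ i → (p - i) j ≡ true
-⁺ {i = i} {j} pj j≢i rewrite pj | dec-false (j ≟ i) j≢i = refl

-⁻ : ∀ {n} {p : Fin n → Bool} {i j} → (p - i) j ≡ true → p j ≡ true × j ≢ i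
-⁻ {p = p} {i} {j} h with p j | j ≟ i
... | true | no j≢i = refl , j≢i

size-remove : ∀ {n} (p : Fin n → Bool) {i} → p i ≡ true → size p ≡ suc (size (p - i))
size-remove p {zero} p0 rewrite p0 =
  cong suc (sum-cong-≗ λ j → cong 𝟙 (sym (∧-identityʳ (p (suc j)))))
size-remove p {suc i} pi rewrite ∧-identityʳ (p zero) =
  trans (cong (𝟙 (p zero) +_) (size-remove (p ∘ suc) pi)) (+-suc _ _)

size>0 : ∀ {n} {p : Fin n → Bool} {i} → p i ≡ true → 0 < size p
size>0 {p = p} pi rewrite size-remove p pi = s≤s z≤n

size≥2⇒size-remove>0 : ∀ {n} {p : Fin n → Bool} {i} → p i ≡ true → 2 ≤ size p →
                       0 < size (p - i)
size≥2⇒size-remove>0 {p = p} pi 2≤size rewrite size-remove p pi = s≤s⁻¹ 2≤size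

size≥2 : ∀ {n} {p : Fin n → Bool} {i j} → p i ≡ true → p j ≡ true → i ≢ j → 2 ≤ size p
size≥2 {p = p} pi pj i≢j rewrite size-remove p pi =
  s≤s (size>0 {p = p - _} (-⁺ {p = p} pj (i≢j ∘ sym)))

size≡2⇒pair : ∀ {n} {p : Fin n → Bool} {a b} → size p ≡ 2 → p a ≡ true → p b ≡ true →
              a ≢ b → ∀ {u} → p u ≡ true → u ≡ a ⊎ u ≡ b
size≡2⇒pair {p = p} {a} {b} size≡2 pa pb a≢b {u} pu with u ≟ a | u ≟ b
... | yes u≡a | _       = inj₁ u≡a
... | no _    | yes u≡b = inj₂ u≡b
... | no u≢a  | no u≢b  = ⊥-elim (<-irrefl refl (subst (0 <_) size[p-a-b]≡0 u∈p-a-b))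
  where
  size[p-a-b]≡0 : size ((p - a) - b) ≡ 0
  size[p-a-b]≡0 = suc-injective (suc-injective (begin
    suc (suc (size ((p - a) - b))) ≡⟨ cong suc (size-remove (p - a) (-⁺ {p = p} pb (a≢b ∘ sym))) ⟨
    suc (size (p - a))             ≡⟨ size-remove p pa ⟨
    size p                         ≡⟨ size≡2 ⟩
    2                              ∎))
    where open ≡-Reasoning
  u∈p-a-b : 0 < size ((p - a) - b)
  u∈p-a-b = size>0 {p = (p - a) - b} (-⁺ {p = p - a} (-⁺ {p = p} pu u≢a) u≢b)

pick : ∀ {n} → (Fin n → Bool) → Fin n → Fin n
pick p d with any? (λ i → p i Bool.≟ true)
... | yes (i , _) = i
... | no _        = d

pick-spec : ∀ {n} (p : Fin n → Bool) d → p (pick p d) ≡ true ⊎ pick p d ≡ d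
pick-spec p d with any? (λ i → p i Bool.≟ true)
... | yes (_ , pi) = inj₁ pi
... | no _         = inj₂ refl

size>0⇒pick : ∀ {n} {p : Fin n → Bool} d → 0 < size p → p (pick p d) ≡ true
size>0⇒pick {p = p} d pos with any? (λ i → p i Bool.≟ true)
... | yes (_ , pi) = pi
... | no none      = ⊥-elim (none (size>0⇒∃ p pos))

module _ {m n} (f : Fin m → Fin n) (p : Fin m → Bool) where

  fibre : Fin n → Fin m → Bool
  fibre t x = p x ∧ does (f x ≟ t)

  fibre⁺ : ∀ {t x} → p x ≡ true → f x ≡ t → fibre t x ≡ true
  fibre⁺ {x = x} px refl rewrite px = dec-true (f x ≟ f x) refl

  fibre⁻ : ∀ {t x} → fibre t x ≡ true → p x ≡ true × f x ≡ t
  fibre⁻ {t} {x} h with p x | f x ≟ t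
  ... | true | yes fx≡t = refl , fx≡t

  image : Fin n → Bool
  image t = does (any? λ x → fibre t x Bool.≟ true)

  image⁺ : ∀ {x} → p x ≡ true → image (f x) ≡ true
  image⁺ {x} px = dec-true (any? _) (x , fibre⁺ px refl)

  image⁻ : ∀ {t} → image t ≡ true → ∃[ x ] fibre t x ≡ true
  image⁻ {t} h with any? (λ x → fibre t x Bool.≟ true)
  ... | yes found = found

  ∑-size-fibre : ∑[ t < n ] size (fibre t) ≡ size p
  ∑-size-fibre = trans (∑-comm (λ t x → 𝟙 (fibre t x))) (sum-cong-≗ 𝟙-fibres)
    where
    𝟙-fibres : ∀ x → ∑[ t < n ] 𝟙 (fibre t x) ≡ 𝟙 (p x)
    𝟙-fibres x with p x
    ... | true  = size-≟ (f x)
    ... | false = sum-replicate-zero n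

  size-image+size≤size : (q : Fin n → Bool) → (∀ {t} → q t ≡ true → 2 ≤ size (fibre t)) →
                         size image + size q ≤ size p
  size-image+size≤size q q⇒2≤fibre = begin
    size image + size q                 ≡⟨ ∑-distrib-+ (𝟙 ∘ image) (𝟙 ∘ q) ⟨
    ∑[ t < n ] (𝟙 (image t) + 𝟙 (q t))  ≤⟨ ∑-mono-≤ 𝟙-image+𝟙≤fibre ⟩
    ∑[ t < n ] size (fibre t)           ≡⟨ ∑-size-fibre ⟩
    size p                              ∎
    where
    open ≤-Reasoning
    𝟙-image+𝟙≤fibre : ∀ t → 𝟙 (image t) + 𝟙 (q t) ≤ size (fibre t)
    𝟙-image+𝟙≤fibre t with q t in qt | image t in it
    ... | true  | true  = q⇒2≤fibre qt
    ... | true  | false = ≤-trans (n≤1+n 1) (q⇒2≤fibre qt)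
    ... | false | true  = size>0 {p = fibre t} (proj₂ (image⁻ it))
    ... | false | false = z≤n

∣tabulate∣≡size : ∀ {n} (p : Fin n → Bool) → ∣ tabulate p ∣ ≡ size p
∣tabulate∣≡size {zero}  p = refl
∣tabulate∣≡size {suc n} p with p zero
... | true  = cong suc (∣tabulate∣≡size (p ∘ suc))
... | false = ∣tabulate∣≡size (p ∘ suc)

∈-tabulate⁺ : ∀ {n} {p : Fin n → Bool} {i} → p i ≡ true → i ∈ tabulate p
∈-tabulate⁺ {p = p} {i} pi = lookup⇒[]= i (tabulate p) (trans (lookup∘tabulate p i) pi)

∈-tabulate⁻ : ∀ {n} {p : Fin n → Bool} {i} → i ∈ tabulate p → p i ≡ true
∈-tabulate⁻ {p = p} {i} i∈p = trans (sym (lookup∘tabulate p i)) ([]=⇒lookup i∈p)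

length-filter-tabulate : ∀ {a} {A : Set a} {n} (p : A → Bool) (f : Fin n → A) →
                         length (filter (λ x → Bool.T? (p x)) (List.tabulate f)) ≡ size (p ∘ f)
length-filter-tabulate {n = zero}  p f = refl
length-filter-tabulate {n = suc n} p f with p (f zero)
... | true  = cong suc (length-filter-tabulate p (f ∘ suc))
... | false = length-filter-tabulate p (f ∘ suc)

local-minimum : ∀ {a k} {C : Set a} (Φ : C → ℕ) (move : C → Fin k → C) → C →
                ∃[ c ] ∀ i → Φ c ≤ Φ (move c i)
local-minimum Φ move c₀ = descend c₀ (<-wellFounded (Φ c₀))
  where
  descend : ∀ c → Acc _<_ (Φ c) → ∃[ c′ ] ∀ i → Φ c′ ≤ Φ (move c′ i)
  descend c (acc smaller) with any? (λ i → Φ (move c i) <? Φ c)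
  ... | yes (i , Φ-decreases) = descend (move c i) (smaller Φ-decreases)
  ... | no  no-improvement    = c , λ i → ≮⇒≥ (λ Φ-decreases → no-improvement (i , Φ-decreases))

module _ {n} (G : Graph n) where

  adjacent-sym : ∀ {u v} → u ~[ G ] v → v ~[ G ] u
  adjacent-sym {u} {v} u~v = trans (Graph.sym G v u) u~v

  deg≡size : ∀ v → deg G v ≡ size (adj G v)
  deg≡size v = length-filter-tabulate (adj G v) id

  ∈-degSet : ∀ {v d} → deg G v ≡ d → v ∈ degSet G d
  ∈-degSet {v} {d} deg≡d = ∈-tabulate⁺ (Equivalence.to T-≡ (≡⇒≡ᵇ (deg G v) d deg≡d))

  𝒮 ℒ : Fin n → Bool
  𝒮 v = deg G v ≡ᵇ 2
  ℒ v = deg G v ≡ᵇ 3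

  𝒮⁻ : ∀ {v} → 𝒮 v ≡ true → deg G v ≡ 2
  𝒮⁻ {v} v∈𝒮 = ≡ᵇ⇒≡ (deg G v) 2 (Equivalence.from T-≡ v∈𝒮)

  ℒ⁻ : ∀ {v} → ℒ v ≡ true → deg G v ≡ 3
  ℒ⁻ {v} v∈ℒ = ≡ᵇ⇒≡ (deg G v) 3 (Equivalence.from T-≡ v∈ℒ)

  𝒮-false : ∀ {v} → deg G v ≢ 2 → 𝒮 v ≡ false
  𝒮-false deg≢2 = ¬-not (deg≢2 ∘ 𝒮⁻)

  isRestrainedDominating-tabulate : (p : Fin n → Bool) →
    (∀ v → p v ≡ false → (∃[ u ] (v ~[ G ] u × p u ≡ true)) × (∃[ u ] (v ~[ G ] u × p u ≡ false))) →
    IsRestrainedDominating G (tabulate p)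
  isRestrainedDominating-tabulate p restrained v v∉p with restrained v (¬-not (v∉p ∘ ∈-tabulate⁺))
  ... | (u , v~u , pu) , (w , v~w , pw) =
    (u , v~u , ∈-tabulate⁺ pu) , (w , v~w , λ w∈p → not-¬ (∈-tabulate⁻ w∈p) pw)

  neighbours-of-degree-2 : ∀ {s a b} → deg G s ≡ 2 → s ~[ G ] a → s ~[ G ] b → a ≢ b →
                           ∀ {u} → s ~[ G ] u → u ≡ a ⊎ u ≡ b
  neighbours-of-degree-2 {s} deg≡2 = size≡2⇒pair (trans (sym (deg≡size s)) deg≡2)

  another-neighbour : ∀ {v w} → 2 ≤ deg G v → v ~[ G ] w → ∃[ t ] (v ~[ G ] t × t ≢ w)
  another-neighbour {v} {w} 2≤deg v~w =
    Product.map₂ (-⁻ {p = adj G v})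
      (size>0⇒∃ (adj G v - w) (size≥2⇒size-remove>0 {p = adj G v} v~w (subst (2 ≤_) (deg≡size v) 2≤deg)))

  end₁ end₂ : Fin n → Fin n
  end₁ s = pick (adj G s) s
  end₂ s = pick (adj G s - end₁ s) s

  end₁-adjacent : ∀ {v} → 0 < deg G v → v ~[ G ] end₁ v
  end₁-adjacent {v} deg>0 = size>0⇒pick v (subst (0 <_) (deg≡size v) deg>0)

  module _ {s} (deg≡2 : deg G s ≡ 2) where

    s~end₁ : s ~[ G ] end₁ s
    s~end₁ = end₁-adjacent (subst (0 <_) (sym deg≡2) (s≤s z≤n))

    private
      end₂-spec : (adj G s - end₁ s) (end₂ s) ≡ true
      end₂-spec = size>0⇒pick s (size≥2⇒size-remove>0 {p = adj G s} s~end₁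
                                   (subst (2 ≤_) (trans (sym deg≡2) (deg≡size s)) ≤-refl))

    s~end₂ : s ~[ G ] end₂ s
    s~end₂ = proj₁ (-⁻ {p = adj G s} end₂-spec)

    end₁≢end₂ : end₁ s ≢ end₂ s
    end₁≢end₂ = proj₂ (-⁻ {p = adj G s} end₂-spec) ∘ sym

    neighbour-is-end : ∀ {u} → s ~[ G ] u → u ≡ end₁ s ⊎ u ≡ end₂ s
    neighbour-is-end = neighbours-of-degree-2 deg≡2 s~end₁ s~end₂ end₁≢end₂

    non-end-not-adjacent : ∀ {v} → v ≢ end₁ s → v ≢ end₂ s → adj G v s ≡ false
    non-end-not-adjacent v≢end₁ v≢end₂ =
      ¬-not λ v~s → [ v≢end₁ , v≢end₂ ]′ (neighbour-is-end (adjacent-sym v~s))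

  Colouring : Set
  Colouring = Fin n → Bool

  monochromatic : Colouring → Fin n → Bool
  monochromatic c s = 𝒮 s ∧ not (c (end₁ s) xor c (end₂ s))

  toggle : Colouring → Fin n → Colouring
  toggle c v = updateAt c v not

  monochromatic-toggle : ∀ c v {s} → deg G s ≡ 2 →
                         monochromatic (toggle c v) s ≡ adj G v s xor monochromatic c s
  monochromatic-toggle c v {s} deg≡2 rewrite deg≡2 with v ≟ end₁ s | v ≟ end₂ s
  ... | yes refl | _
    rewrite updateAt-updates (end₁ s) {not} c
          | updateAt-minimal (end₂ s) (end₁ s) {not} c (end₁≢end₂ deg≡2 ∘ sym)
          | adjacent-sym (s~end₁ deg≡2)
          = cong not (sym (not-distribˡ-xor (c (end₁ s)) (c (end₂ s))))
  ... | no v≢end₁ | yes refl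
    rewrite updateAt-updates (end₂ s) {not} c
          | updateAt-minimal (end₁ s) (end₂ s) {not} c (end₁≢end₂ deg≡2)
          | adjacent-sym (s~end₂ deg≡2)
          = cong not (sym (not-distribʳ-xor (c (end₁ s)) (c (end₂ s))))
  ... | no v≢end₁ | no v≢end₂
    rewrite updateAt-minimal (end₁ s) v {not} c (v≢end₁ ∘ sym)
          | updateAt-minimal (end₂ s) v {not} c (v≢end₂ ∘ sym)
          | non-end-not-adjacent deg≡2 v≢end₁ v≢end₂
          = refl

  Φ : Colouring → ℕ
  Φ c = size (monochromatic c)

  Φ-toggle : ∀ c v → Φ (toggle c v) + size (λ s → adj G v s ∧ monochromatic c s)
                     ≤ Φ c + size (λ s → adj G v s ∧ not (monochromatic c s))
  Φ-toggle c v = begin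
    Φ (toggle c v) + size (λ s → adj G v s ∧ monochromatic c s)
      ≡⟨ ∑-distrib-+ (𝟙 ∘ monochromatic (toggle c v)) _ ⟨
    ∑[ s < n ] (𝟙 (monochromatic (toggle c v) s) + 𝟙 (adj G v s ∧ monochromatic c s))
      ≤⟨ ∑-mono-≤ pointwise ⟩
    ∑[ s < n ] (𝟙 (monochromatic c s) + 𝟙 (adj G v s ∧ not (monochromatic c s)))
      ≡⟨ ∑-distrib-+ (𝟙 ∘ monochromatic c) _ ⟩
    Φ c + size (λ s → adj G v s ∧ not (monochromatic c s))
      ∎
    where
    open ≤-Reasoning
    𝟙-xor : ∀ a m → 𝟙 (a xor m) + 𝟙 (a ∧ m) ≤ 𝟙 m + 𝟙 (a ∧ not m)
    𝟙-xor true  true  = ≤-refl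
    𝟙-xor true  false = ≤-refl
    𝟙-xor false m     = ≤-refl
    𝟙-∧ : ∀ a → 𝟙 (a ∧ false) ≤ 𝟙 (a ∧ true)
    𝟙-∧ true  = z≤n
    𝟙-∧ false = z≤n
    pointwise : ∀ s → 𝟙 (monochromatic (toggle c v) s) + 𝟙 (adj G v s ∧ monochromatic c s)
                      ≤ 𝟙 (monochromatic c s) + 𝟙 (adj G v s ∧ not (monochromatic c s))
    pointwise s with deg G s ℕ.≟ 2
    ... | yes deg≡2 rewrite monochromatic-toggle c v deg≡2 = 𝟙-xor (adj G v s) _
    ... | no  deg≢2 rewrite 𝒮-false deg≢2 = 𝟙-∧ (adj G v s)

  LocallyMinimal : Colouring → Set
  LocallyMinimal c = ∀ v → Φ c ≤ Φ (toggle c v)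

  MonochromaticMatching : Colouring → Set
  MonochromaticMatching c = ∀ {x s t} → x ~[ G ] s → x ~[ G ] t →
                            monochromatic c s ≡ true → monochromatic c t ≡ true → s ≡ t

  locallyMinimal⇒matching : (∀ v → deg G v ≤ 3) → ∀ {c} → LocallyMinimal c →
                            MonochromaticMatching c
  locallyMinimal⇒matching Δ≤3 {c} minimal {x} {s} {t} x~s x~t s-mono t-mono with s ≟ t
  ... | yes s≡t = s≡t
  ... | no  s≢t = ⊥-elim (<-irrefl refl (begin
    4              ≤⟨ +-mono-≤ 2≤I 2≤I ⟩
    I + I          ≤⟨ +-monoʳ-≤ I I≤K ⟩
    I + K          ≡⟨ size-split (adj G x) (monochromatic c) ⟨
    size (adj G x) ≡⟨ deg≡size x ⟨
    deg G x        ≤⟨ Δ≤3 x ⟩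
    3              ∎))
    where
    open ≤-Reasoning
    I = size (λ u → adj G x u ∧ monochromatic c u)
    K = size (λ u → adj G x u ∧ not (monochromatic c u))
    2≤I : 2 ≤ I
    2≤I = size≥2 {p = λ u → adj G x u ∧ monochromatic c u}
                 (cong₂ _∧_ x~s s-mono) (cong₂ _∧_ x~t t-mono) s≢t
    I≤K : I ≤ K
    I≤K = +-cancelˡ-≤ (Φ c) I K (≤-trans (+-monoˡ-≤ I (minimal x)) (Φ-toggle c x))

  matching-not : ∀ {c} → MonochromaticMatching c → MonochromaticMatching (not ∘ c)
  matching-not {c} matching x~s x~t s-mono t-mono =
    matching x~s x~t (trans (sym (monochromatic-not _)) s-mono)
                     (trans (sym (monochromatic-not _)) t-mono)
    where
    monochromatic-not : ∀ s → monochromatic (not ∘ c) s ≡ monochromatic c s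
    monochromatic-not s = cong (λ b → 𝒮 s ∧ not b) (xor-annihilates-not (c (end₁ s)) (c (end₂ s)))

  internal : Colouring → Fin n → Bool
  internal c s = 𝒮 s ∧ c (end₁ s) ∧ c (end₂ s)

  internal⁺ : ∀ {c s} → deg G s ≡ 2 → (∀ {u} → s ~[ G ] u → c u ≡ true) →
              internal c s ≡ true
  internal⁺ deg≡2 neighbours-true
    rewrite deg≡2 | neighbours-true (s~end₁ deg≡2) | neighbours-true (s~end₂ deg≡2) = refl

  internal⁻ : ∀ {c s} → internal c s ≡ true →
              deg G s ≡ 2 × (∀ {u} → s ~[ G ] u → c u ≡ true)
  internal⁻ {c} {s} s-internal = deg≡2 , neighbours-true
    where
    ends-true : c (end₁ s) ∧ c (end₂ s) ≡ true
    ends-true = ∧-conicalʳ (𝒮 s) _ s-internal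
    deg≡2 : deg G s ≡ 2
    deg≡2 = 𝒮⁻ (∧-conicalˡ (𝒮 s) _ s-internal)
    neighbours-true : ∀ {u} → s ~[ G ] u → c u ≡ true
    neighbours-true s~u =
      [ (λ u≡end₁ → subst (λ u → c u ≡ true) (sym u≡end₁) (∧-conicalˡ _ _ ends-true))
      , (λ u≡end₂ → subst (λ u → c u ≡ true) (sym u≡end₂) (∧-conicalʳ _ _ ends-true))
      ]′ (neighbour-is-end deg≡2 s~u)

  internal⇒monochromatic : ∀ {c s} → internal c s ≡ true → monochromatic c s ≡ true
  internal⇒monochromatic {c} {s} = same-colour (𝒮 s) (c (end₁ s)) (c (end₂ s))
    where
    same-colour : ∀ a x y → a ∧ x ∧ y ≡ true → a ∧ not (x xor y) ≡ true
    same-colour true true true _ = refl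

  -- The class coloured true plays the role of X; passing to not ∘ c swaps the two classes.
  balanced-colouring : ∀ {c} → MonochromaticMatching c →
                       ∃[ c′ ] MonochromaticMatching c′ × size (internal (not ∘ c′)) ≤ size (internal c′)
  balanced-colouring {c} matching with ≤-total (size (internal (not ∘ c))) (size (internal c))
  ... | inj₁ balanced = c , matching , balanced
  ... | inj₂ balanced =
    not ∘ c , matching-not {c} matching , subst (_≤ size (internal (not ∘ c))) (sym not-not) balanced
    where
    not-not : size (internal (not ∘ not ∘ c)) ≡ size (internal c)
    not-not = sum-cong-≗ λ s → cong 𝟙 (cong₂ (λ x y → 𝒮 s ∧ x ∧ y)
                                              (not-involutive (c (end₁ s))) (not-involutive (c (end₂ s))))

module Bipartite₂₃ {n} (G : Graph n) (Δ≤3 : ∀ v → deg G v ≤ 3) (2≤δ : ∀ v → 2 ≤ deg G v)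
  (𝒮-independent : Independent G (degSet G 2)) (ℒ-independent : Independent G (degSet G 3)) where

  deg≡2⊎3 : ∀ v → deg G v ≡ 2 ⊎ deg G v ≡ 3
  deg≡2⊎3 v with deg G v | 2≤δ v | Δ≤3 v
  ... | 2 | _ | _ = inj₁ refl
  ... | 3 | _ | _ = inj₂ refl
  ... | 1 | s≤s () | _
  ... | suc (suc (suc (suc _))) | _ | s≤s (s≤s (s≤s ()))

  neighbour-of-𝒮 : ∀ {s u} → deg G s ≡ 2 → s ~[ G ] u → deg G u ≡ 3
  neighbour-of-𝒮 {s} {u} deg-s≡2 s~u with deg≡2⊎3 u
  ... | inj₁ deg-u≡2 = ⊥-elim (𝒮-independent s u (∈-degSet G deg-s≡2) (∈-degSet G deg-u≡2) s~u)
  ... | inj₂ deg-u≡3 = deg-u≡3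

  neighbour-of-ℒ : ∀ {x u} → deg G x ≡ 3 → x ~[ G ] u → deg G u ≡ 2
  neighbour-of-ℒ {x} {u} deg-x≡3 x~u with deg≡2⊎3 u
  ... | inj₁ deg-u≡2 = deg-u≡2
  ... | inj₂ deg-u≡3 = ⊥-elim (ℒ-independent x u (∈-degSet G deg-x≡3) (∈-degSet G deg-u≡3) x~u)

  module RestrainedDominatingSet (c : Colouring G) (matching : MonochromaticMatching G c)
    (balanced : size (internal G (not ∘ c)) ≤ size (internal G c)) where

    X B : Fin n → Bool
    X v = ℒ G v ∧ c v
    B v = ℒ G v ∧ not (c v)

    X⁺ : ∀ {x} → deg G x ≡ 3 → c x ≡ true → X x ≡ true
    X⁺ deg≡3 cx≡true rewrite deg≡3 | cx≡true = refl

    π : Fin n → Fin n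
    π x = pick (λ s → adj G x s ∧ internal G c s) (end₁ G x)

    D : Fin n → Bool
    D v = B v ∨ image π X v ∨ internal G (not ∘ c) v

    π-adjacent : ∀ x → x ~[ G ] π x
    π-adjacent x with pick-spec (λ s → adj G x s ∧ internal G c s) (end₁ G x)
    ... | inj₁ found  = ∧-conicalˡ _ _ found
    ... | inj₂ π≡end₁ = subst (x ~[ G ]_) (sym π≡end₁) (end₁-adjacent G (≤-trans (s≤s z≤n) (2≤δ x)))

    π-internal : ∀ {x t} → x ~[ G ] t → internal G c t ≡ true → π x ≡ t
    π-internal {x} {t} x~t t-internal =
      matching (∧-conicalˡ _ _ found) x~t
               (internal⇒monochromatic G {c} (∧-conicalʳ (adj G x (π x)) _ found))
               (internal⇒monochromatic G {c} t-internal)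
      where
      found : adj G x (π x) ∧ internal G c (π x) ≡ true
      found = size>0⇒pick (end₁ G x)
                (size>0 {p = λ s → adj G x s ∧ internal G c s} (cong₂ _∧_ x~t t-internal))

    image-π⇒deg≡2 : ∀ {s} → image π X s ≡ true → deg G s ≡ 2
    image-π⇒deg≡2 s∈image with image⁻ π X s∈image
    ... | x , in-fibre with fibre⁻ π X in-fibre
    ... | x∈X , refl = neighbour-of-ℒ (ℒ⁻ G (∧-conicalˡ _ _ x∈X)) (π-adjacent x)

    deg≡3⇒∉image-π : ∀ {x} → deg G x ≡ 3 → image π X x ≡ false
    deg≡3⇒∉image-π deg≡3 = ¬-not λ x∈image → 3≢2 (trans (sym deg≡3) (image-π⇒deg≡2 x∈image))
      where
      3≢2 : 3 ≢ 2
      3≢2 ()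

    D-on-ℒ : ∀ {x} → deg G x ≡ 3 → D x ≡ not (c x)
    D-on-ℒ {x} deg≡3 rewrite deg≡3 | deg≡3⇒∉image-π deg≡3 = ∨-identityʳ (not (c x))

    D-on-𝒮 : ∀ {s} → deg G s ≡ 2 → D s ≡ image π X s ∨ internal G (not ∘ c) s
    D-on-𝒮 deg≡2 rewrite deg≡2 = refl

    image-π⇒D : ∀ {s} → image π X s ≡ true → D s ≡ true
    image-π⇒D {s} s∈image rewrite s∈image = ∨-zeroʳ (B s)

    other-neighbour∉image-π : ∀ {v t} → X v ≡ true → v ~[ G ] t → t ≢ π v → image π X t ≡ false
    other-neighbour∉image-π {v} {t} v∈X v~t t≢πv = ¬-not λ t∈image → t≢πv (sym (πv≡t t∈image))
      where
      πv≡t : image π X t ≡ true → π v ≡ t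
      πv≡t t∈image with image⁻ π X t∈image
      ... | x , in-fibre with fibre⁻ π X in-fibre
      ... | x∈X , πx≡t with x ≟ v
      ...   | yes refl = πx≡t
      ...   | no  x≢v  = π-internal v~t (internal⁺ G deg-t≡2 neighbours-true)
        where
        deg-t≡2 : deg G t ≡ 2
        deg-t≡2 = neighbour-of-ℒ (ℒ⁻ G (∧-conicalˡ _ _ v∈X)) v~t
        x~t : x ~[ G ] t
        x~t = subst (x ~[ G ]_) πx≡t (π-adjacent x)
        t-neighbours : ∀ {u} → t ~[ G ] u → u ≡ v ⊎ u ≡ x
        t-neighbours = neighbours-of-degree-2 G deg-t≡2 (adjacent-sym G v~t) (adjacent-sym G x~t) (x≢v ∘ sym)
        neighbours-true : ∀ {u} → t ~[ G ] u → c u ≡ true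
        neighbours-true t~u with t-neighbours t~u
        ... | inj₁ refl = ∧-conicalʳ _ _ v∈X
        ... | inj₂ refl = ∧-conicalʳ _ _ x∈X

    Restrained : Fin n → Set
    Restrained v = (∃[ u ] (v ~[ G ] u × D u ≡ true)) × (∃[ u ] (v ~[ G ] u × D u ≡ false))

    ℒ-restrained : ∀ {v} → deg G v ≡ 3 → D v ≡ false → Restrained v
    ℒ-restrained {v} deg≡3 v∉D with another-neighbour G (2≤δ v) (π-adjacent v)
    ... | t , v~t , t≢πv = (π v , π-adjacent v , image-π⇒D (image⁺ π X v∈X)) , (t , v~t , t∉D)
      where
      c-v : c v ≡ true
      c-v = not-injective (trans (sym (D-on-ℒ deg≡3)) v∉D)
      v∈X : X v ≡ true
      v∈X = X⁺ deg≡3 c-v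
      t∉internal′ : internal G (not ∘ c) t ≡ false
      t∉internal′ = ¬-not λ t-internal →
        not-¬ c-v (not-injective (proj₂ (internal⁻ G {not ∘ c} t-internal) (adjacent-sym G v~t)))
      t∉D : D t ≡ false
      t∉D rewrite D-on-𝒮 (neighbour-of-ℒ deg≡3 v~t) | other-neighbour∉image-π v∈X v~t t≢πv = t∉internal′

    different-colours⇒restrained : ∀ {s x y} → deg G s ≡ 2 → s ~[ G ] x → s ~[ G ] y →
                                   c x ≡ true → c y ≡ false → Restrained s
    different-colours⇒restrained deg≡2 s~x s~y c-x c-y =
      (_ , s~y , trans (D-on-ℒ (neighbour-of-𝒮 deg≡2 s~y)) (cong not c-y)) ,
      (_ , s~x , trans (D-on-ℒ (neighbour-of-𝒮 deg≡2 s~x)) (cong not c-x))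

    𝒮-restrained : ∀ {s} → deg G s ≡ 2 → D s ≡ false → Restrained s
    𝒮-restrained {s} deg≡2 s∉D = by-colours (c a) (c b) refl refl
      where
      a = end₁ G s
      b = end₂ G s
      s~a : s ~[ G ] a
      s~a = s~end₁ G deg≡2
      s~b : s ~[ G ] b
      s~b = s~end₂ G deg≡2
      s∉image : image π X s ≡ false
      s∉image = ∨-conicalˡ _ _ (trans (sym (D-on-𝒮 deg≡2)) s∉D)
      s∉internal′ : internal G (not ∘ c) s ≡ false
      s∉internal′ = ∨-conicalʳ (image π X s) _ (trans (sym (D-on-𝒮 deg≡2)) s∉D)
      by-colours : ∀ α β → c a ≡ α → c b ≡ β → Restrained s
      by-colours true true c-a c-b =
        ⊥-elim (not-¬ (image⁺ π X (X⁺ (neighbour-of-𝒮 deg≡2 s~a) c-a)) s∉πa)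
        where
        s-internal : internal G c s ≡ true
        s-internal rewrite deg≡2 | c-a | c-b = refl
        s∉πa : image π X (π a) ≡ false
        s∉πa rewrite π-internal (adjacent-sym G s~a) s-internal = s∉image
      by-colours false false c-a c-b = ⊥-elim (not-¬ s-internal′ s∉internal′)
        where
        s-internal′ : internal G (not ∘ c) s ≡ true
        s-internal′ rewrite deg≡2 | c-a | c-b = refl
      by-colours true  false c-a c-b = different-colours⇒restrained deg≡2 s~a s~b c-a c-b
      by-colours false true  c-a c-b = different-colours⇒restrained deg≡2 s~b s~a c-b c-a

    D-restrained : IsRestrainedDominating G (tabulate D)
    D-restrained = isRestrainedDominating-tabulate G D λ v v∉D →
      [ (λ deg≡2 → 𝒮-restrained deg≡2 v∉D) , (λ deg≡3 → ℒ-restrained deg≡3 v∉D) ]′ (deg≡2⊎3 v)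

    internal⇒2≤fibre : ∀ {t} → internal G c t ≡ true → 2 ≤ size (fibre π X t)
    internal⇒2≤fibre {t} t-internal =
      size≥2 {p = fibre π X t} (in-fibre (s~end₁ G deg≡2)) (in-fibre (s~end₂ G deg≡2))
             (end₁≢end₂ G deg≡2)
      where
      deg≡2 = proj₁ (internal⁻ G {c} t-internal)
      in-fibre : ∀ {x} → t ~[ G ] x → fibre π X t x ≡ true
      in-fibre t~x = fibre⁺ π X (X⁺ (neighbour-of-𝒮 deg≡2 t~x) (proj₂ (internal⁻ G {c} t-internal) t~x))
                                (π-internal (adjacent-sym G t~x) t-internal)

    size-D≤size-ℒ : size D ≤ size (ℒ G)
    size-D≤size-ℒ = begin
      size D
        ≤⟨ size-∨ B _ ⟩
      size B + size (λ v → image π X v ∨ internal G (not ∘ c) v)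
        ≤⟨ +-monoʳ-≤ (size B) (size-∨ (image π X) (internal G (not ∘ c))) ⟩
      size B + (size (image π X) + size (internal G (not ∘ c)))
        ≤⟨ +-monoʳ-≤ (size B) (+-monoʳ-≤ _ balanced) ⟩
      size B + (size (image π X) + size (internal G c))
        ≤⟨ +-monoʳ-≤ (size B) image+internal≤X ⟩
      size B + size X
        ≡⟨ +-comm (size B) (size X) ⟩
      size X + size B
        ≡⟨ size-split (ℒ G) c ⟨
      size (ℒ G)
        ∎
      where
      open ≤-Reasoning
      image+internal≤X : size (image π X) + size (internal G c) ≤ size X
      image+internal≤X = size-image+size≤size π X (internal G c) internal⇒2≤fibre

    γr≤∣ℒ∣ : γr≤ G ∣ degSet G 3 ∣
    γr≤∣ℒ∣ = tabulate D , D-restrained ,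
             subst₂ _≤_ (sym (∣tabulate∣≡size D)) (sym (∣tabulate∣≡size (ℒ G))) size-D≤size-ℒ

lemma1 : ∀ {n} (G : Graph n) →
         (∀ v → deg G v ≤ 3) →
         (∀ v → 2 ≤ deg G v) →
         Independent G (degSet G 2) →
         Independent G (degSet G 3) →
         γr≤ G ∣ degSet G 3 ∣
lemma1 G Δ≤3 2≤δ 𝒮-independent ℒ-independent =
  let c₀ , minimal            = local-minimum (Φ G) (toggle G) (λ _ → true)
      c , matching , balanced = balanced-colouring G {c₀} (locallyMinimal⇒matching G Δ≤3 {c₀} minimal)
  in RestrainedDominatingSet.γr≤∣ℒ∣ c matching balanced
  where open Bipartite₂₃ G Δ≤3 2≤δ 𝒮-independent ℒ-independent
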